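{- Let $k\ge 2$ and $m\ge 0$ be integers and let $n=k(m+1)-1$. Then every $k$-uniform linear hypergraph on $n$ vertices not containing the $k$-fan $F^k$ as a subhypergraph has at most $m^2+m$ edges, i.e. $\mathrm{ex}_{\rm lin}(n,F^k)\le m^2+m$. Moreover, every truncated design obtained from a transversal design on $n+1$ vertices with $k$ groups is a $k$-uniform linear $F^k$-free hypergraph on $n$ vertices with exactly $m^2+m$ edges (so it is extremal).
   Context: A $k$-uniform hypergraph is linear if any two distinct edges share at most one vertex; containment as a subhypergraph means some subset of edges forms an isomorphic copy (not necessarily induced). $\mathrm{ex}_{\rm lin}(n,\mathcal F)$ is the maximum number of edges of a $k$-uniform linear hypergraph on $n$ vertices containing no member of $\mathcal F$. The $k$-fan $F^k$ is the linear $k$-uniform hypergraph with edges $f_1,\dots,f_k,g$, where $f_1,\dots,f_k$ share a common vertex $v$ (pairwise meeting only in $v$) and $g$ avoids $v$ and meets each $f_i$ in exactly one vertex. A transversal design on $N$ vertices with $k$ groups is a $k$-uniform hypergraph whose vertices are partitioned into $k$ groups of size $N/k$ such that each edge has one vertex in each group and each pair of vertices from different groups lies in exactly one edge. A truncated design is obtained from a transversal design by deleting one vertex and all edges containing it. -}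

module Defs where

open import Data.Nat using (ℕ; suc; _*_; _≤_)
open import Data.Fin using (Fin; punchIn; _≟_)
open import Data.Fin.Subset using (Subset; _∈_; _∉_; _∩_; ∣_∣)
open import Data.Fin.Subset.Properties using (_∈?_)
open import Data.Vec using (tabulate) renaming (lookup to vlookup)
open import Data.List using (List; length; lookup; filter; map)
open import Data.List.Relation.Unary.All using (All)
open import Data.List.Relation.Unary.Unique.Propositional using (Unique)
open import Data.Product using (Σ; _×_)
open import Function.Definitions using (Injective)
open import Relation.Binary.PropositionalEquality using (_≡_; _≢_)
open import Relation.Nullary using (¬_; does; ¬?)

-- A hypergraph on vertex set Fin n is a list of edges (subsets of Fin n);
-- the edge *set* is required to be repetition-free via `Unique`.
-- Its number of edges is `length E`.

Uniform : ∀ {n} → ℕ → List (Subset n) → Set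
Uniform k E = All (λ e → ∣ e ∣ ≡ k) E

Linear : ∀ {n} → List (Subset n) → Set
Linear E = ∀ (i j : Fin (length E)) → i ≢ j → ∣ lookup E i ∩ lookup E j ∣ ≤ 1

ContainsFan : ∀ {n} → ℕ → List (Subset n) → Set
ContainsFan {n} k E =
  Σ (Fin n) λ v →
  Σ (Fin k → Fin (length E)) λ f →
  Σ (Fin (length E)) λ g →
    Injective _≡_ _≡_ f
  × (∀ i → v ∈ lookup E (f i))
  × (∀ i j → i ≢ j → ∀ x → x ∈ lookup E (f i) → x ∈ lookup E (f j) → x ≡ v)
  × v ∉ lookup E g
  × (∀ i → ∣ lookup E g ∩ lookup E (f i) ∣ ≡ 1)

Group : ∀ {N k} → (Fin N → Fin k) → Fin k → Subset N
Group grp c = tabulate (λ x → does (grp x ≟ c))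

TransversalDesign : (k N : ℕ) → List (Subset N) → (Fin N → Fin k) → Set
TransversalDesign k N E grp =
    Unique E
  × Uniform k E
  × (∀ c → ∣ Group grp c ∣ * k ≡ N)
  × All (λ e → ∀ c → ∣ e ∩ Group grp c ∣ ≡ 1) E
  × (∀ x y → grp x ≢ grp y →
       Σ (Fin (length E)) λ i →
         (x ∈ lookup E i × y ∈ lookup E i)
       × (∀ j → x ∈ lookup E j → y ∈ lookup E j → j ≡ i))

-- restrict a subset of Fin (suc n) avoiding w to Fin n (relabel via punchIn w)
restrict : ∀ {n} → Fin (suc n) → Subset (suc n) → Subset n
restrict w e = tabulate (λ i → vlookup e (punchIn w i))

truncate : ∀ {n} → Fin (suc n) → List (Subset (suc n)) → List (Subset n)
truncate w E = map (restrict w) (filter (λ e → ¬? (w ∈? e)) E)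

module Submission where

-- Let v be a vertex of maximum degree Δ.  If Δ ≤ m, counting
-- incidences gives e·k ≤ n·m < k·(m² + m).  Otherwise count around v: by
-- linearity the edges through v cover Δ·(k - 1) vertices besides v, leaving M
-- "far" vertices, with Δ·(k - 1) + 1 + M = n.  An edge avoiding v with no far
-- vertex would have each of its k vertices joined to v by its own edge, which
-- is a k-fan; so every edge not through v has a far vertex, e ≤ Δ + M·Δ, and
-- the vertex count turns this into e ≤ m² + m.
--
-- Pair counting in a transversal design with groups of size
-- m + 1 gives (m + 1)² edges and degree m + 1, so deleting a vertex leaves
-- m² + m edges.  Uniqueness, uniformity and linearity survive the deletion, and
-- every remaining edge still meets every group once, which excludes k-fans.

open import Defs
open import Data.Nat using (ℕ; suc; _+_; _*_; _≤_)
open import Data.Fin using (Fin)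
open import Data.Fin.Subset using (Subset)
open import Data.List using (List; length)
open import Data.List.Relation.Unary.Unique.Propositional using (Unique)
open import Data.Product using (_×_)
open import Relation.Binary.PropositionalEquality using (_≡_)
open import Relation.Nullary using (¬_)

open import Data.Bool using (Bool; true; false; _∧_)
open import Data.Empty using (⊥-elim)
open import Data.Fin using (zero; suc; punchIn; punchOut) renaming (_≟_ to _≟ᶠ_)
import Data.Fin.Properties as Finₚ
open import Data.Fin.Subset using (_∈_; _∉_; _∩_; ∣_∣; ⁅_⁆; Nonempty)
open import Data.Fin.Subset.Properties
  using (_∈?_; x∈p∩q⁺; x∈p∩q⁻; x∈p⇒∣p-x∣<∣p∣; x∈p∧x≢y⇒x∈p-y; nonempty?; Empty-unique; ∣⊥∣≡0; ∩-comm;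
         x∈⁅x⁆; x∈⁅y⁆⇒x≡y; x≢y⇒x∉⁅y⁆; ∣⁅x⁆∣≡1)
open import Data.List using ([]; _∷_; lookup)
import Data.List.Relation.Unary.All as All
open import Data.List.Relation.Unary.All using (All; []; _∷_)
open import Data.List.Relation.Unary.AllPairs using (AllPairs; []; _∷_)
import Data.List.Relation.Unary.Any as Any
open import Data.List.Relation.Unary.Any.Properties using (lookup-index)
open import Data.List.Membership.Propositional.Properties using (∈-lookup)
open import Data.Nat using (zero; _∸_; _<_; z≤n; s≤s; z<s; NonZero; _≤?_; _<?_)
open import Data.Nat.Properties
open import Data.Nat.Tactic.RingSolver using (solve-∀)
open import Data.Product using (Σ; ∃; _,_; proj₁; proj₂)
import Data.Vec as Vec
open import Data.Vec using ([]; _∷_; here; there)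
open import Data.Vec.Properties using ([]=⇒lookup; lookup⇒[]=; lookup-zipWith; lookup∘tabulate; tabulate∘lookup; tabulate-cong)
open import Function using (_∘_)
open import Function.Definitions using (Injective)
open import Relation.Binary.PropositionalEquality
  using (_≢_; refl; sym; trans; cong; cong₂; subst; module ≡-Reasoning)
open import Relation.Nullary using (yes; no; does; contradiction)
open import Relation.Nullary.Decidable using (dec-true; dec-false)
open import Algebra.Properties.Semiring.Sum +-*-semiring
  using (sum; sum-syntax; sum-cong-≗; ∑-comm; ∑-distrib-+; sum-remove; *-distribˡ-sum; *-distribʳ-sum)

sum-const : ∀ n (c : ℕ) → ∑[ i < n ] c ≡ n * c
sum-const zero    c = refl
sum-const (suc n) c = cong (c +_) (sum-const n c)

sum-mono : ∀ {n} {f g : Fin n → ℕ} → (∀ i → f i ≤ g i) → sum f ≤ sum g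
sum-mono {zero}  f≤g = z≤n
sum-mono {suc n} f≤g = +-mono-≤ (f≤g zero) (sum-mono (f≤g ∘ suc))

term≤sum : ∀ {n} (f : Fin n → ℕ) i → f i ≤ sum f
term≤sum {suc n} f i = subst (f i ≤_) (sym (sum-remove {i = i} f)) (m≤m+n (f i) _)

sum-except : ∀ {n} (f : Fin (suc n) → ℕ) i c → (∀ j → j ≢ i → f j ≡ c) → sum f ≡ f i + n * c
sum-except {n} f i c others = begin
  sum f                            ≡⟨ sum-remove {i = i} f ⟩
  f i + ∑[ j < n ] f (punchIn i j) ≡⟨ cong (f i +_) (sum-cong-≗ (λ j → others _ (Finₚ.punchInᵢ≢i i j))) ⟩
  f i + ∑[ j < n ] c               ≡⟨ cong (f i +_) (sum-const n c) ⟩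
  f i + n * c                      ∎
  where open ≡-Reasoning

sum-single : ∀ {n} (f : Fin n → ℕ) i → (∀ j → j ≢ i → f j ≡ 0) → sum f ≡ f i
sum-single {suc n} f i others = trans (sum-except f i 0 others) (trans (cong (f i +_) (*-zeroʳ n)) (+-identityʳ (f i)))

positive-term : ∀ {n} (f : Fin n → ℕ) → 0 < sum f → ∃ λ i → 0 < f i
positive-term {suc n} f pos with 0 <? f zero
... | yes f₀>0 = zero , f₀>0
... | no  f₀≯0 with positive-term (f ∘ suc) (subst (λ z → 0 < z + sum (f ∘ suc)) (n≤0⇒n≡0 (≮⇒≥ f₀≯0)) pos)
...   | i , fᵢ>0 = suc i , fᵢ>0

sum≤1 : ∀ {n} (f : Fin n → ℕ) → (∀ i → f i ≤ 1) → (∀ i j → 0 < f i → 0 < f j → i ≡ j) → sum f ≤ 1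
sum≤1 {zero}  f ≤1 unique = z≤n
sum≤1 {suc n} f ≤1 unique with 0 <? f zero
... | yes f₀>0 = subst (_≤ 1) (sym (sum-single f zero vanish)) (≤1 zero)
  where
  vanish : ∀ j → j ≢ zero → f j ≡ 0
  vanish j j≢0 = n≤0⇒n≡0 (≮⇒≥ (λ fⱼ>0 → j≢0 (unique j zero fⱼ>0 f₀>0)))
... | no f₀≯0 = subst (λ z → z + sum (f ∘ suc) ≤ 1) (sym (n≤0⇒n≡0 (≮⇒≥ f₀≯0)))
                  (sum≤1 (f ∘ suc) (≤1 ∘ suc) (λ i j p q → Finₚ.suc-injective (unique (suc i) (suc j) p q)))

sum-tight : ∀ {n} {f g : Fin n → ℕ} → (∀ i → f i ≤ g i) → sum g ≤ sum f → ∀ i → f i ≡ g i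
sum-tight {suc n} {f} {g} f≤g g≤f i = ≤-antisym (f≤g i) (+-cancelʳ-≤ _ (g i) (f i) (begin
  g i + rest g ≡⟨ sum-remove {i = i} g ⟨
  sum g        ≤⟨ g≤f ⟩
  sum f        ≡⟨ sum-remove {i = i} f ⟩
  f i + rest f ≤⟨ +-monoʳ-≤ (f i) (sum-mono (f≤g ∘ punchIn i)) ⟩
  f i + rest g ∎))
  where
  open ≤-Reasoning
  rest : (Fin (suc n) → ℕ) → ℕ
  rest h = ∑[ j < n ] h (punchIn i j)

argmax : ∀ {n} (f : Fin (suc n) → ℕ) → ∃ λ v → ∀ x → f x ≤ f v
argmax {zero}  f = zero , λ { zero → ≤-refl }
argmax {suc n} f with argmax (f ∘ suc)
... | v , max with f zero ≤? f (suc v)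
...   | yes f₀≤ = suc v , λ { zero → f₀≤ ; (suc x) → max x }
...   | no  f₀≰ = zero  , λ { zero → ≤-refl ; (suc x) → ≤-trans (max x) (<⇒≤ (≰⇒> f₀≰)) }

bit : Bool → ℕ
bit true  = 1
bit false = 0

χ : ∀ {n} → Subset n → Fin n → ℕ
χ p x = bit (Vec.lookup p x)

∣p∣≡∑χ : ∀ {n} (p : Subset n) → ∣ p ∣ ≡ sum (χ p)
∣p∣≡∑χ []          = refl
∣p∣≡∑χ (true ∷ p)  = cong suc (∣p∣≡∑χ p)
∣p∣≡∑χ (false ∷ p) = ∣p∣≡∑χ p

module _ {n : ℕ} {p : Subset n} {x : Fin n} where

  ∉⇒false : x ∉ p → Vec.lookup p x ≡ false
  ∉⇒false x∉p with Vec.lookup p x in eq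
  ... | true  = contradiction (lookup⇒[]= x p eq) x∉p
  ... | false = refl

  χ-∈ : x ∈ p → χ p x ≡ 1
  χ-∈ x∈p = cong bit ([]=⇒lookup x∈p)

  χ-∉ : x ∉ p → χ p x ≡ 0
  χ-∉ x∉p = cong bit (∉⇒false x∉p)

  χ>0⇒∈ : 0 < χ p x → x ∈ p
  χ>0⇒∈ pos with x ∈? p
  ... | yes x∈p = x∈p
  ... | no  x∉p = contradiction (subst (0 <_) (χ-∉ x∉p) pos) (<-irrefl refl)

  χ≤1 : χ p x ≤ 1
  χ≤1 with Vec.lookup p x
  ... | true  = ≤-refl
  ... | false = z≤n

χ-∩ : ∀ {n} (p q : Subset n) x → χ (p ∩ q) x ≡ χ p x * χ q x
χ-∩ p q x = trans (cong bit (lookup-zipWith _∧_ x p q)) (bit-∧ (Vec.lookup p x) (Vec.lookup q x))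
  where
  bit-∧ : ∀ a b → bit (a ∧ b) ≡ bit a * bit b
  bit-∧ true  b = sym (+-identityʳ (bit b))
  bit-∧ false b = refl

χ-square : ∀ {n} (p : Subset n) x → χ p x * χ p x ≡ χ p x
χ-square p x with Vec.lookup p x
... | true  = refl
... | false = refl

*-positive : ∀ m n → 0 < m * n → 0 < m × 0 < n
*-positive (suc m) (suc n) _ = z<s , z<s
*-positive (suc m) zero pos = contradiction (subst (0 <_) (*-zeroʳ (suc m)) pos) (<-irrefl refl)

∣p∩q∣≡∑χχ : ∀ {n} (p q : Subset n) → ∣ p ∩ q ∣ ≡ ∑[ x < n ] (χ p x * χ q x)
∣p∩q∣≡∑χχ p q = trans (∣p∣≡∑χ (p ∩ q)) (sum-cong-≗ (χ-∩ p q))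

∣p∩⁅x⁆∣≡χ : ∀ {n} (p : Subset n) x → ∣ p ∩ ⁅ x ⁆ ∣ ≡ χ p x
∣p∩⁅x⁆∣≡χ p x = begin
  ∣ p ∩ ⁅ x ⁆ ∣                 ≡⟨ ∣p∩q∣≡∑χχ p ⁅ x ⁆ ⟩
  sum (λ y → χ p y * χ ⁅ x ⁆ y) ≡⟨ sum-single _ x (λ y y≢x → trans (cong (χ p y *_) (χ-∉ (x≢y⇒x∉⁅y⁆ y≢x))) (*-zeroʳ (χ p y))) ⟩
  χ p x * χ ⁅ x ⁆ x             ≡⟨ cong (χ p x *_) (χ-∈ (x∈⁅x⁆ x)) ⟩
  χ p x * 1                     ≡⟨ *-identityʳ (χ p x) ⟩
  χ p x                         ∎
  where open ≡-Reasoning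

∈⇒∣p∣≥1 : ∀ {n} {p : Subset n} {x} → x ∈ p → 1 ≤ ∣ p ∣
∈⇒∣p∣≥1 x∈p = ≤-trans (s≤s z≤n) (x∈p⇒∣p-x∣<∣p∣ x∈p)

∈⇒∣p∣≥2 : ∀ {n} {p : Subset n} {x y} → x ∈ p → y ∈ p → x ≢ y → 2 ≤ ∣ p ∣
∈⇒∣p∣≥2 x∈p y∈p x≢y = ≤-trans (s≤s (∈⇒∣p∣≥1 (x∈p∧x≢y⇒x∈p-y y∈p (x≢y ∘ sym)))) (x∈p⇒∣p-x∣<∣p∣ x∈p)

∣p∣≥1⇒∈ : ∀ {n} (p : Subset n) → 1 ≤ ∣ p ∣ → Nonempty p
∣p∣≥1⇒∈ {n} p pos with nonempty? p
... | yes nonempty = nonempty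
... | no  empty    = contradiction (subst (λ q → 1 ≤ ∣ q ∣) (Empty-unique empty) pos)
                                   (<-irrefl (sym (∣⊥∣≡0 n)))

∣p∣≤1 : ∀ {n} (p : Subset n) → (∀ x y → x ∈ p → y ∈ p → x ≡ y) → ∣ p ∣ ≤ 1
∣p∣≤1 p unique = subst (_≤ 1) (sym (∣p∣≡∑χ p))
  (sum≤1 (χ p) (λ x → χ≤1 {p = p} {x}) (λ x y x>0 y>0 → unique x y (χ>0⇒∈ x>0) (χ>0⇒∈ y>0)))

enumerate : ∀ {n k} (p : Subset n) → ∣ p ∣ ≡ k →
            Σ (Fin k → Fin n) λ list → Injective _≡_ _≡_ list × (∀ a → list a ∈ p)
enumerate [] refl = (λ ()) , (λ {}) , (λ ())
enumerate (false ∷ p) refl with enumerate p refl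
... | list , injective , member = suc ∘ list , injective ∘ Finₚ.suc-injective , there ∘ member
enumerate (true ∷ p) refl with enumerate p refl
... | list , injective , member = list′ , injective′ , member′
  where
  list′ : Fin (suc ∣ p ∣) → Fin _
  list′ zero    = zero
  list′ (suc a) = suc (list a)
  injective′ : Injective _≡_ _≡_ list′
  injective′ {zero}  {zero}  _  = refl
  injective′ {suc a} {suc b} eq = cong suc (injective (Finₚ.suc-injective eq))
  member′ : ∀ a → list′ a ∈ (true ∷ p)
  member′ zero    = here
  member′ (suc a) = there (member a)

∈-own-group : ∀ {n k} (col : Fin n → Fin k) x → x ∈ Group col (col x)
∈-own-group col x = lookup⇒[]= x _ (trans (lookup∘tabulate _ x) (dec-true (col x ≟ᶠ col x) refl))

∈-group⇒colour : ∀ {n k} (col : Fin n → Fin k) {x c} → x ∈ Group col c → col x ≡ c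
∈-group⇒colour col {x} {c} x∈ with col x ≟ᶠ c
... | yes colx≡c = colx≡c
... | no  colx≢c = contradiction (trans (sym ([]=⇒lookup x∈)) (trans (lookup∘tabulate _ x) (dec-false (col x ≟ᶠ c) colx≢c))) (λ ())

-- Degrees and codegrees in a hypergraph given by its list of edges

allAt : ∀ {A : Set} {P : A → Set} {xs : List A} → All P xs → ∀ i → P (lookup xs i)
allAt ps i = All.lookup ps (∈-lookup i)

deg : ∀ {n} → List (Subset n) → Fin n → ℕ
deg E x = ∑[ i < length E ] χ (lookup E i) x

codeg : ∀ {n} → List (Subset n) → Fin n → Fin n → ℕ
codeg E x y = ∑[ i < length E ] (χ (lookup E i) x * χ (lookup E i) y)

handshake : ∀ {n k} {E : List (Subset n)} → Uniform k E → ∑[ x < n ] deg E x ≡ length E * k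
handshake {n} {k} {E} uniform = begin
  ∑[ x < n ] deg E x                     ≡⟨ ∑-comm (λ x i → χ (lookup E i) x) ⟩
  ∑[ i < length E ] sum (χ (lookup E i)) ≡⟨ sum-cong-≗ (λ i → trans (sym (∣p∣≡∑χ (lookup E i))) (allAt uniform i)) ⟩
  ∑[ i < length E ] k                    ≡⟨ sum-const (length E) k ⟩
  length E * k                           ∎
  where open ≡-Reasoning

-- pairs (edge through v, vertex of that edge), counted in two ways
star-sum : ∀ {n k} {E : List (Subset n)} → Uniform k E → ∀ v → ∑[ x < n ] codeg E v x ≡ deg E v * k
star-sum {n} {k} {E} uniform v = begin
  ∑[ x < n ] codeg E v x                            ≡⟨ ∑-comm (λ x i → χ (e i) v * χ (e i) x) ⟩
  ∑[ i < length E ] ∑[ x < n ] (χ (e i) v * χ (e i) x) ≡⟨ sum-cong-≗ (λ i → *-distribˡ-sum (χ (e i) v) (χ (e i))) ⟨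
  ∑[ i < length E ] (χ (e i) v * sum (χ (e i)))     ≡⟨ sum-cong-≗ (λ i → cong (χ (e i) v *_) (trans (sym (∣p∣≡∑χ (e i))) (allAt uniform i))) ⟩
  ∑[ i < length E ] (χ (e i) v * k)                 ≡⟨ *-distribʳ-sum k (λ i → χ (e i) v) ⟨
  deg E v * k                                       ∎
  where
  open ≡-Reasoning
  e : Fin (length E) → Subset n
  e = lookup E

codeg-self : ∀ {n} (E : List (Subset n)) v → codeg E v v ≡ deg E v
codeg-self E v = sum-cong-≗ (λ i → χ-square (lookup E i) v)

common-edge : ∀ {n} {E : List (Subset n)} {x y} → 0 < codeg E x y → ∃ λ i → x ∈ lookup E i × y ∈ lookup E i
common-edge {E = E} {x} {y} pos with positive-term _ pos
... | i , term>0 with *-positive (χ (lookup E i) x) _ term>0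
...   | x>0 , y>0 = i , χ>0⇒∈ x>0 , χ>0⇒∈ y>0

not-both : ∀ {n} {p : Subset n} {x y} → ¬ (x ∈ p × y ∈ p) → χ p x * χ p y ≡ 0
not-both {p = p} {x} {y} ¬both with x ∈? p | y ∈? p
... | yes x∈p | yes y∈p = contradiction (x∈p , y∈p) ¬both
... | yes _   | no  y∉p = trans (cong (χ p x *_) (χ-∉ y∉p)) (*-zeroʳ (χ p x))
... | no  x∉p | _       = cong (_* χ p y) (χ-∉ x∉p)

linear-unique-edge : ∀ {n} {E : List (Subset n)} → Linear E → ∀ {x y i j} → x ≢ y →
  x ∈ lookup E i → y ∈ lookup E i → x ∈ lookup E j → y ∈ lookup E j → i ≡ j
linear-unique-edge linear {i = i} {j} x≢y x∈i y∈i x∈j y∈j with i ≟ᶠ j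
... | yes i≡j = i≡j
... | no  i≢j = contradiction (linear i j i≢j)
                  (<⇒≱ (∈⇒∣p∣≥2 (x∈p∩q⁺ (x∈i , x∈j)) (x∈p∩q⁺ (y∈i , y∈j)) x≢y))

linear-codeg≤1 : ∀ {n} {E : List (Subset n)} → Linear E → ∀ {x y} → x ≢ y → codeg E x y ≤ 1
linear-codeg≤1 {E = E} linear {x} {y} x≢y =
  sum≤1 _ (λ i → *-mono-≤ (χ≤1 {p = lookup E i} {x}) (χ≤1 {p = lookup E i} {y})) unique
  where
  both : ∀ i → 0 < χ (lookup E i) x * χ (lookup E i) y → x ∈ lookup E i × y ∈ lookup E i
  both i pos with *-positive (χ (lookup E i) x) _ pos
  ... | x>0 , y>0 = χ>0⇒∈ x>0 , χ>0⇒∈ y>0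
  unique : ∀ i j → 0 < χ (lookup E i) x * χ (lookup E i) y → 0 < χ (lookup E j) x * χ (lookup E j) y → i ≡ j
  unique i j i>0 j>0 with both i i>0 | both j j>0
  ... | x∈i , y∈i | x∈j , y∈j = linear-unique-edge {E = E} linear x≢y x∈i y∈i x∈j y∈j

-- Fans

covered-edge-fan : ∀ {n k} {E : List (Subset n)} → Uniform k E → Linear E →
  ∀ v g → v ∉ lookup E g → (∀ x → x ∈ lookup E g → 0 < codeg E v x) → ContainsFan k E
covered-edge-fan {n} {k} {E} uniform linear v g v∉g covered =
  v , spoke , g , spoke-injective , v∈spoke , spokes-meet-in-v , v∉g , base-meets-spoke
  where
  listing = enumerate (lookup E g) (allAt uniform g)
  vertex : Fin k → Fin n
  vertex = proj₁ listing
  vertex∈g : ∀ a → vertex a ∈ lookup E g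
  vertex∈g = proj₂ (proj₂ listing)

  join : ∀ a → ∃ λ j → v ∈ lookup E j × vertex a ∈ lookup E j
  join a = common-edge {E = E} (covered (vertex a) (vertex∈g a))
  spoke : Fin k → Fin (length E)
  spoke a = proj₁ (join a)
  v∈spoke : ∀ a → v ∈ lookup E (spoke a)
  v∈spoke a = proj₁ (proj₂ (join a))
  vertex∈spoke : ∀ a → vertex a ∈ lookup E (spoke a)
  vertex∈spoke a = proj₂ (proj₂ (join a))

  g≢spoke : ∀ a → g ≢ spoke a
  g≢spoke a g≡spoke = v∉g (subst (λ j → v ∈ lookup E j) (sym g≡spoke) (v∈spoke a))

  -- two vertices of g on one spoke would make that spoke meet g twice
  spoke-injective : Injective _≡_ _≡_ spoke
  spoke-injective {a} {b} same with a ≟ᶠ b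
  ... | yes a≡b = a≡b
  ... | no  a≢b = contradiction
        (linear-unique-edge {E = E} linear (a≢b ∘ proj₁ (proj₂ listing)) (vertex∈g a) (vertex∈g b)
           (vertex∈spoke a) (subst (λ j → vertex b ∈ lookup E j) (sym same) (vertex∈spoke b)))
        (g≢spoke a)

  spokes-meet-in-v : ∀ a b → a ≢ b → ∀ x → x ∈ lookup E (spoke a) → x ∈ lookup E (spoke b) → x ≡ v
  spokes-meet-in-v a b a≢b x x∈a x∈b with x ≟ᶠ v
  ... | yes x≡v = x≡v
  ... | no  x≢v = contradiction
        (spoke-injective (linear-unique-edge {E = E} linear (x≢v ∘ sym) (v∈spoke a) x∈a (v∈spoke b) x∈b)) a≢b

  base-meets-spoke : ∀ a → ∣ lookup E g ∩ lookup E (spoke a) ∣ ≡ 1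
  base-meets-spoke a = ≤-antisym (linear g (spoke a) (g≢spoke a))
                                 (∈⇒∣p∣≥1 (x∈p∩q⁺ (vertex∈g a , vertex∈spoke a)))

-- Conversely, in any k-fan of a k-uniform hypergraph the spokes cover the base
-- edge g: they meet g in k vertices, pairwise distinct as spokes meet only in v ∉ g.
spokes-cover-base : ∀ {n k} {E : List (Subset n)} → Uniform k E →
  ∀ {v} (spoke : Fin k → Fin (length E)) g →
  (∀ a b → a ≢ b → ∀ x → x ∈ lookup E (spoke a) → x ∈ lookup E (spoke b) → x ≡ v) →
  v ∉ lookup E g → (∀ a → ∣ lookup E g ∩ lookup E (spoke a) ∣ ≡ 1) →
  ∀ x → x ∈ lookup E g → ∃ λ a → x ∈ lookup E (spoke a)
spokes-cover-base {n} {k} {E} uniform {v} spoke g spokes-meet v∉g base-meets x x∈g =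
  proj₁ spoke-through-x , χ>0⇒∈ (proj₂ spoke-through-x)
  where
  B : Subset n
  B = lookup E g
  S : Fin k → Subset n
  S a = lookup E (spoke a)
  on-spokes : Fin n → ℕ
  on-spokes y = χ B y * ∑[ a < k ] χ (S a) y

  at-most-once : ∀ y → on-spokes y ≤ χ B y
  at-most-once y with y ∈? B
  ... | no  y∉B rewrite χ-∉ y∉B = z≤n
  ... | yes y∈B rewrite χ-∈ y∈B = subst (_≤ 1) (sym (+-identityʳ _))
        (sum≤1 (λ a → χ (S a) y) (λ a → χ≤1 {p = S a} {y}) distinct-spokes)
    where
    distinct-spokes : ∀ a b → 0 < χ (S a) y → 0 < χ (S b) y → a ≡ b
    distinct-spokes a b y∈a y∈b with a ≟ᶠ b
    ... | yes a≡b = a≡b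
    ... | no  a≢b = contradiction (subst (_∈ B) (spokes-meet a b a≢b y (χ>0⇒∈ y∈a) (χ>0⇒∈ y∈b)) y∈B) v∉g

  total : sum on-spokes ≡ sum (χ B)
  total = begin
    ∑[ y < n ] (χ B y * ∑[ a < k ] χ (S a) y) ≡⟨ sum-cong-≗ (λ y → *-distribˡ-sum (χ B y) (λ a → χ (S a) y)) ⟩
    ∑[ y < n ] ∑[ a < k ] (χ B y * χ (S a) y) ≡⟨ ∑-comm (λ y a → χ B y * χ (S a) y) ⟩
    ∑[ a < k ] ∑[ y < n ] (χ B y * χ (S a) y) ≡⟨ sum-cong-≗ (λ a → trans (sym (∣p∩q∣≡∑χχ B (S a))) (base-meets a)) ⟩
    ∑[ a < k ] 1                              ≡⟨ trans (sum-const k 1) (*-identityʳ k) ⟩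
    k                                         ≡⟨ trans (sym (allAt uniform g)) (∣p∣≡∑χ B) ⟩
    sum (χ B)                                 ∎
    where open ≡-Reasoning

  spoke-through-x : ∃ λ a → 0 < χ (S a) x
  spoke-through-x = positive-term _ (proj₂ (*-positive (χ B x) _
    (subst (0 <_) (sym (sum-tight at-most-once (≤-reflexive (sym total)) x)) (subst (0 <_) (sym (χ-∈ x∈g)) z<s))))

-- A hypergraph whose vertices are coloured with k colours so that every edge
-- meets every colour class exactly once contains no k-fan: the vertex of the
-- base coloured like the centre v lies on a spoke, which then meets v's class twice.
transversal-fan-free : ∀ {n k} {E : List (Subset n)} (col : Fin n → Fin k) → Uniform k E →
  All (λ e → ∀ c → ∣ e ∩ Group col c ∣ ≡ 1) E → ¬ ContainsFan k E
transversal-fan-free {E = E} col uniform transversal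
  (v , spoke , g , _ , v∈spoke , spokes-meet , v∉g , base-meets)
  with ∣p∣≥1⇒∈ (lookup E g ∩ Group col (col v)) (≤-reflexive (sym (allAt transversal g (col v))))
... | u , u∈g∩class with x∈p∩q⁻ (lookup E g) _ u∈g∩class
...   | u∈g , u∈class with spokes-cover-base uniform spoke g spokes-meet v∉g base-meets u u∈g
...     | a , u∈spoke = <⇒≱ class-met-twice (≤-reflexive (allAt transversal (spoke a) (col v)))
  where
  u≢v : u ≢ v
  u≢v u≡v = v∉g (subst (_∈ lookup E g) u≡v u∈g)
  class-met-twice : 2 ≤ ∣ lookup E (spoke a) ∩ Group col (col v) ∣
  class-met-twice = ∈⇒∣p∣≥2 (x∈p∩q⁺ (u∈spoke , u∈class)) (x∈p∩q⁺ (v∈spoke a , ∈-own-group col v)) u≢v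

-- A vertex is far from v if no edge contains both; every vertex other than v is
-- either joined to v by exactly one edge or far from v.
module StarCounting {n k : ℕ} {E : List (Subset (suc n))} (uniform : Uniform k E) (linear : Linear E)
                    (v : Fin (suc n)) where

  far : Fin (suc n) → ℕ
  far x = 1 ∸ codeg E v x

  joined-or-far : ∀ x → x ≢ v → codeg E v x + far x ≡ 1
  joined-or-far x x≢v = m+[n∸m]≡n (linear-codeg≤1 {E = E} linear (x≢v ∘ sym))

  -- the star of v covers deg(v)·(k-1) vertices besides v; the others are far
  far-balance : 0 < deg E v → deg E v * k + sum far + 1 ≡ suc n + deg E v
  far-balance Δ>0 = begin
    deg E v * k + sum far + 1                     ≡⟨ cong (λ z → z + sum far + 1) (star-sum uniform v) ⟨
    sum (codeg E v) + sum far + 1                 ≡⟨ cong (_+ 1) (∑-distrib-+ (codeg E v) far) ⟨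
    ∑[ x < suc n ] (codeg E v x + far x) + 1      ≡⟨ cong (_+ 1) (sum-except _ v 1 joined-or-far) ⟩
    codeg E v v + far v + n * 1 + 1               ≡⟨ cong (λ z → z + n * 1 + 1) centre ⟩
    deg E v + n * 1 + 1                           ≡⟨ rearrange (deg E v) n ⟩
    suc n + deg E v                               ∎
    where
    open ≡-Reasoning
    rearrange : ∀ d n → d + n * 1 + 1 ≡ suc n + d
    rearrange = solve-∀
    centre : codeg E v v + far v ≡ deg E v
    centre rewrite codeg-self E v = trans (cong (deg E v +_) (m≤n⇒m∸n≡0 Δ>0)) (+-identityʳ _)

  far-on : Fin (length E) → ℕ
  far-on i = ∑[ x < suc n ] (far x * χ (lookup E i) x)

  edge-sees-v-or-far : ¬ ContainsFan k E → ∀ i → 1 ≤ χ (lookup E i) v + far-on i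
  edge-sees-v-or-far fan-free i with v ∈? lookup E i
  ... | yes v∈i = subst (λ z → 1 ≤ z + far-on i) (sym (χ-∈ v∈i)) (s≤s z≤n)
  ... | no  v∉i with 0 <? far-on i
  ...   | yes far-vertex = ≤-trans far-vertex (m≤n+m (far-on i) (χ (lookup E i) v))
  ...   | no  none = contradiction (covered-edge-fan uniform linear v i v∉i covered) fan-free
    where
    covered : ∀ x → x ∈ lookup E i → 0 < codeg E v x
    covered x x∈i = m∸n≡0⇒m≤n (n≤0⇒n≡0 (subst (_≤ 0) (trans (cong (far x *_) (χ-∈ x∈i)) (*-identityʳ _))
                      (≤-trans (term≤sum (λ y → far y * χ (lookup E i) y) x) (≮⇒≥ none))))

  edge-bound : ¬ ContainsFan k E → (∀ x → deg E x ≤ deg E v) → length E ≤ deg E v + sum far * deg E v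
  edge-bound fan-free maximal = begin
    length E                                           ≡⟨ trans (sym (*-identityʳ _)) (sym (sum-const (length E) 1)) ⟩
    ∑[ i < length E ] 1                                ≤⟨ sum-mono (edge-sees-v-or-far fan-free) ⟩
    ∑[ i < length E ] (χ (e i) v + far-on i)           ≡⟨ ∑-distrib-+ (λ i → χ (e i) v) far-on ⟩
    deg E v + ∑[ i < length E ] ∑[ x < suc n ] (far x * χ (e i) x)
                                                       ≡⟨ cong (deg E v +_) (∑-comm (λ i x → far x * χ (e i) x)) ⟩
    deg E v + ∑[ x < suc n ] ∑[ i < length E ] (far x * χ (e i) x)
                                                       ≡⟨ cong (deg E v +_) (sum-cong-≗ (λ x → *-distribˡ-sum (far x) (λ i → χ (e i) x))) ⟨
    deg E v + ∑[ x < suc n ] (far x * deg E x)         ≤⟨ +-monoʳ-≤ (deg E v) (sum-mono (λ x → *-monoʳ-≤ (far x) (maximal x))) ⟩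
    deg E v + ∑[ x < suc n ] (far x * deg E v)         ≡⟨ cong (deg E v +_) (*-distribʳ-sum (deg E v) far) ⟨
    deg E v + sum far * deg E v                        ∎
    where
    open ≤-Reasoning
    e : Fin (length E) → Subset (suc n)
    e = lookup E

low-degree-bound : ∀ {k m N e} .{{_ : NonZero k}} → suc N ≡ k * suc m → e * k ≤ N * m → e ≤ m * m + m
low-degree-bound {k} {m} {N} {e} vertices ek≤Nm = *-cancelʳ-≤ e (m * m + m) k (begin
  e * k           ≤⟨ ek≤Nm ⟩
  N * m           ≤⟨ *-monoˡ-≤ m (n≤1+n N) ⟩
  suc N * m       ≡⟨ cong (_* m) vertices ⟩
  k * suc m * m   ≡⟨ expand k m ⟩
  (m * m + m) * k ∎)
  where
  open ≤-Reasoning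
  expand : ∀ k m → k * suc m * m ≡ (m * m + m) * k
  expand = solve-∀

-- Large maximum degree Δ = m + 1 + t with M far vertices: the balance
-- Δ·k + M + 1 = N + Δ forces m = M + 1 + t·(k - 1), and then Δ·(M + 1) ≤ m² + m.
high-degree-bound : ∀ {k' m N Δ M e} → suc N ≡ (2 + k') * suc m → suc m ≤ Δ →
  Δ * (2 + k') + M + 1 ≡ N + Δ → e ≤ Δ + M * Δ → e ≤ m * m + m
high-degree-bound {k'} {m} {N} {Δ} {M} {e} vertices m<Δ balance e≤ with m≤n⇒∃[o]m+o≡n m<Δ
... | t , refl = ≤-trans e≤ (subst (λ m → suc m + t + M * (suc m + t) ≤ m * m + m) (sym far-count) product-bound)
  where
  open ≡-Reasoning
  shift₁ : ∀ m t k' M → (2 + k') * suc m + (M + 1 + t * suc k' + (1 + t)) ≡ (suc m + t) * (2 + k') + M + 1 + 1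
  shift₁ = solve-∀
  shift₂ : ∀ N m t → N + (suc m + t) + 1 ≡ suc N + (m + (1 + t))
  shift₂ = solve-∀
  far-count : m ≡ M + 1 + t * suc k'
  far-count = sym (+-cancelʳ-≡ (1 + t) _ _ (+-cancelˡ-≡ ((2 + k') * suc m) _ _ (begin
    (2 + k') * suc m + (M + 1 + t * suc k' + (1 + t)) ≡⟨ shift₁ m t k' M ⟩
    (suc m + t) * (2 + k') + M + 1 + 1               ≡⟨ cong (_+ 1) balance ⟩
    N + (suc m + t) + 1                              ≡⟨ shift₂ N m t ⟩
    suc N + (m + (1 + t))                            ≡⟨ cong (_+ (m + (1 + t))) vertices ⟩
    (2 + k') * suc m + (m + (1 + t))                 ∎)))
  -- with A = M + 1 and s = t·(k - 1) ≥ t: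
  -- (A + s)(A + s + 1) = (A + s + 1 + t)·A + t·(k - 2)·A + s·(s + 1)
  square-split : ∀ M t k' → (M + 1 + t * suc k') * (M + 1 + t * suc k') + (M + 1 + t * suc k') ≡
    (suc (M + 1 + t * suc k') + t + M * (suc (M + 1 + t * suc k') + t)) +
    (t * k' * (M + 1) + t * suc k' * (t * suc k' + 1))
  square-split = solve-∀
  m′ : ℕ
  m′ = M + 1 + t * suc k'
  product-bound : suc m′ + t + M * (suc m′ + t) ≤ m′ * m′ + m′
  product-bound = ≤-trans (m≤m+n _ (t * k' * (M + 1) + t * suc k' * (t * suc k' + 1)))
                          (≤-reflexive (sym (square-split M t k')))

upper-bound : ∀ k' m n (E : List (Subset (suc n))) → suc (suc n) ≡ (2 + k') * suc m →
  Uniform (2 + k') E → Linear E → ¬ ContainsFan (2 + k') E → length E ≤ m * m + m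
upper-bound k' m n E vertices uniform linear fan-free with argmax (deg E)
... | v , maximal with deg E v ≤? m
...   | yes Δ≤m = low-degree-bound vertices (begin
        length E * (2 + k')    ≡⟨ handshake uniform ⟨
        ∑[ x < suc n ] deg E x ≤⟨ sum-mono (λ x → ≤-trans (maximal x) Δ≤m) ⟩
        ∑[ x < suc n ] m       ≡⟨ sum-const (suc n) m ⟩
        suc n * m              ∎)
  where open ≤-Reasoning
...   | no  Δ≰m = high-degree-bound vertices Δ>m (far-balance (≤-trans (s≤s z≤n) Δ>m)) (edge-bound fan-free maximal)
  where
  open StarCounting uniform linear v
  Δ>m : suc m ≤ deg E v
  Δ>m = ≰⇒> Δ≰m

-- Pair counting

codeg-expansion : ∀ {n} (E : List (Subset n)) (a b : Fin n → ℕ) →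
  ∑[ x < n ] ∑[ y < n ] (codeg E x y * (a x * b y)) ≡
  ∑[ i < length E ] (∑[ x < n ] (χ (lookup E i) x * a x) * ∑[ y < n ] (χ (lookup E i) y * b y))
codeg-expansion {n} E a b = begin
  ∑[ x < n ] ∑[ y < n ] (codeg E x y * (a x * b y))
    ≡⟨ sum-cong-≗ (λ x → sum-cong-≗ (λ y → *-distribʳ-sum (a x * b y) (λ i → χ (e i) x * χ (e i) y))) ⟩
  ∑[ x < n ] ∑[ y < n ] ∑[ i < length E ] (χ (e i) x * χ (e i) y * (a x * b y))
    ≡⟨ sum-cong-≗ (λ x → sum-cong-≗ (λ y → sum-cong-≗ (λ i → regroup (χ (e i) x) (χ (e i) y) (a x) (b y)))) ⟩
  ∑[ x < n ] ∑[ y < n ] ∑[ i < length E ] (χ (e i) x * a x * (χ (e i) y * b y))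
    ≡⟨ sum-cong-≗ (λ x → ∑-comm (λ y i → χ (e i) x * a x * (χ (e i) y * b y))) ⟩
  ∑[ x < n ] ∑[ i < length E ] ∑[ y < n ] (χ (e i) x * a x * (χ (e i) y * b y))
    ≡⟨ ∑-comm (λ x i → ∑[ y < n ] (χ (e i) x * a x * (χ (e i) y * b y))) ⟩
  ∑[ i < length E ] ∑[ x < n ] ∑[ y < n ] (χ (e i) x * a x * (χ (e i) y * b y))
    ≡⟨ sum-cong-≗ (λ i → sum-cong-≗ (λ x → *-distribˡ-sum (χ (e i) x * a x) (λ y → χ (e i) y * b y))) ⟨
  ∑[ i < length E ] ∑[ x < n ] (χ (e i) x * a x * ∑[ y < n ] (χ (e i) y * b y))
    ≡⟨ sum-cong-≗ (λ i → *-distribʳ-sum (∑[ y < n ] (χ (e i) y * b y)) (λ x → χ (e i) x * a x)) ⟨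
  ∑[ i < length E ] (∑[ x < n ] (χ (e i) x * a x) * ∑[ y < n ] (χ (e i) y * b y)) ∎
  where
  open ≡-Reasoning
  e : Fin (length E) → Subset n
  e = lookup E
  regroup : ∀ p q r s → p * q * (r * s) ≡ p * r * (q * s)
  regroup = solve-∀

pair-counting : ∀ {n} (E : List (Subset n)) (A B : Subset n) →
  (∀ {x y} → x ∈ A → y ∈ B → codeg E x y ≡ 1) →
  ∣ A ∣ * ∣ B ∣ ≡ ∑[ i < length E ] (∣ lookup E i ∩ A ∣ * ∣ lookup E i ∩ B ∣)
pair-counting {n} E A B once = begin
  ∣ A ∣ * ∣ B ∣                                        ≡⟨ cong₂ _*_ (∣p∣≡∑χ A) (∣p∣≡∑χ B) ⟩
  sum (χ A) * sum (χ B)                                ≡⟨ *-distribʳ-sum (sum (χ B)) (χ A) ⟩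
  ∑[ x < n ] (χ A x * sum (χ B))                       ≡⟨ sum-cong-≗ (λ x → *-distribˡ-sum (χ A x) (χ B)) ⟩
  ∑[ x < n ] ∑[ y < n ] (χ A x * χ B y)                ≡⟨ sum-cong-≗ (λ x → sum-cong-≗ (weight x)) ⟩
  ∑[ x < n ] ∑[ y < n ] (codeg E x y * (χ A x * χ B y)) ≡⟨ codeg-expansion E (χ A) (χ B) ⟩
  ∑[ i < length E ] (∑[ x < n ] (χ (e i) x * χ A x) * ∑[ y < n ] (χ (e i) y * χ B y))
    ≡⟨ sum-cong-≗ (λ i → cong₂ _*_ (∣p∩q∣≡∑χχ (e i) A) (∣p∩q∣≡∑χχ (e i) B)) ⟨
  ∑[ i < length E ] (∣ e i ∩ A ∣ * ∣ e i ∩ B ∣)       ∎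
  where
  open ≡-Reasoning
  e : Fin (length E) → Subset n
  e = lookup E
  weight : ∀ x y → χ A x * χ B y ≡ codeg E x y * (χ A x * χ B y)
  weight x y with x ∈? A | y ∈? B
  ... | yes x∈A | yes y∈B rewrite once x∈A y∈B = sym (+-identityʳ _)
  ... | yes _   | no  y∉B rewrite χ-∉ y∉B | *-zeroʳ (χ A x) = sym (*-zeroʳ (codeg E x y))
  ... | no  x∉A | _       rewrite χ-∉ x∉A = sym (*-zeroʳ (codeg E x y))

-- Transversal designs

design-codeg : ∀ {k N E grp} → TransversalDesign k N E grp → ∀ {x y} → grp x ≢ grp y → codeg E x y ≡ 1
design-codeg {E = E} (_ , _ , _ , _ , joined) {x} {y} x≁y with joined x y x≁y
... | i , (x∈i , y∈i) , unique =
  trans (sum-single _ i (λ j j≢i → not-both (λ (x∈j , y∈j) → j≢i (unique j x∈j y∈j))))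
        (cong₂ _*_ (χ-∈ x∈i) (χ-∈ y∈i))

-- a transversal design is linear: two common vertices of two edges lie in different
-- groups, as an edge meets each group once, and then determine the edge
design-linear : ∀ {k N E grp} → TransversalDesign k N E grp → Linear E
design-linear {E = E} {grp} (_ , _ , _ , transversal , joined) i j i≢j = ∣p∣≤1 _ same
  where
  same : ∀ x y → x ∈ lookup E i ∩ lookup E j → y ∈ lookup E i ∩ lookup E j → x ≡ y
  same x y x∈ y∈ with x∈p∩q⁻ (lookup E i) _ x∈ | x∈p∩q⁻ (lookup E i) _ y∈ | x ≟ᶠ y
  ... | _ | _ | yes x≡y = x≡y
  ... | x∈i , x∈j | y∈i , y∈j | no x≢y with grp x ≟ᶠ grp y
  ...   | yes grp≡ = contradiction (allAt transversal i (grp x)) (<⇒≱ (∈⇒∣p∣≥2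
            (x∈p∩q⁺ (x∈i , ∈-own-group grp x))
            (x∈p∩q⁺ (y∈i , subst (λ c → y ∈ Group grp c) (sym grp≡) (∈-own-group grp y))) x≢y) ∘ ≤-reflexive)
  ...   | no  grp≢ with joined x y grp≢
  ...     | _ , _ , unique = contradiction (trans (unique i x∈i y∈i) (sym (unique j x∈j y∈j))) i≢j

-- counting pairs from two different groups
design-size : ∀ {k N E grp} → TransversalDesign k N E grp → ∀ {c₁ c₂} → c₁ ≢ c₂ →
  length E ≡ ∣ Group grp c₁ ∣ * ∣ Group grp c₂ ∣
design-size {E = E} {grp} design@(_ , _ , _ , transversal , _) {c₁} {c₂} c₁≢c₂ = begin
  length E                                    ≡⟨ trans (sym (*-identityʳ _)) (sym (sum-const (length E) 1)) ⟩
  ∑[ i < length E ] (1 * 1)                   ≡⟨ sum-cong-≗ (λ i → cong₂ _*_ (allAt transversal i c₁) (allAt transversal i c₂)) ⟨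
  ∑[ i < length E ] (∣ lookup E i ∩ Group grp c₁ ∣ * ∣ lookup E i ∩ Group grp c₂ ∣)
                                              ≡⟨ pair-counting E _ _ different-groups ⟨
  ∣ Group grp c₁ ∣ * ∣ Group grp c₂ ∣         ∎
  where
  open ≡-Reasoning
  different-groups : ∀ {x y} → x ∈ Group grp c₁ → y ∈ Group grp c₂ → codeg E x y ≡ 1
  different-groups x∈ y∈ = design-codeg design
    (λ grp≡ → c₁≢c₂ (trans (sym (∈-group⇒colour grp x∈)) (trans grp≡ (∈-group⇒colour grp y∈))))

-- counting pairs (w, y) with y in a group other than w's
design-degree : ∀ {k N E grp} → TransversalDesign k N E grp → ∀ {c} w → c ≢ grp w →
  deg E w ≡ ∣ Group grp c ∣
design-degree {E = E} {grp} design@(_ , _ , _ , transversal , _) {c} w c≢grpw = begin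
  deg E w                                     ≡⟨ sum-cong-≗ (λ i → *-identityʳ (χ (lookup E i) w)) ⟨
  ∑[ i < length E ] (χ (lookup E i) w * 1)    ≡⟨ sum-cong-≗ (λ i → cong₂ _*_ (∣p∩⁅x⁆∣≡χ (lookup E i) w) (allAt transversal i c)) ⟨
  ∑[ i < length E ] (∣ lookup E i ∩ ⁅ w ⁆ ∣ * ∣ lookup E i ∩ Group grp c ∣)
                                              ≡⟨ pair-counting E _ _ joined-to-w ⟨
  ∣ ⁅ w ⁆ ∣ * ∣ Group grp c ∣                 ≡⟨ cong (_* ∣ Group grp c ∣) (∣⁅x⁆∣≡1 w) ⟩
  1 * ∣ Group grp c ∣                         ≡⟨ *-identityˡ _ ⟩
  ∣ Group grp c ∣                             ∎
  where
  open ≡-Reasoning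
  joined-to-w : ∀ {x y} → x ∈ ⁅ w ⁆ → y ∈ Group grp c → codeg E x y ≡ 1
  joined-to-w {x} x∈ y∈ = design-codeg design
    (λ grp≡ → c≢grpw (trans (sym (∈-group⇒colour grp y∈)) (trans (sym grp≡) (cong grp (x∈⁅y⁆⇒x≡y w x∈)))))

vec-ext : ∀ {A : Set} {n} {u v : Vec.Vec A n} → (∀ i → Vec.lookup u i ≡ Vec.lookup v i) → u ≡ v
vec-ext {u = u} {v} same = trans (sym (tabulate∘lookup u)) (trans (tabulate-cong same) (tabulate∘lookup v))

restrict-lookup : ∀ {n} (w : Fin (suc n)) (p : Subset (suc n)) i →
  Vec.lookup (restrict w p) i ≡ Vec.lookup p (punchIn w i)
restrict-lookup w p i = lookup∘tabulate _ i

restrict-∩ : ∀ {n} (w : Fin (suc n)) (p q : Subset (suc n)) → restrict w (p ∩ q) ≡ restrict w p ∩ restrict w q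
restrict-∩ w p q = vec-ext λ i → begin
  Vec.lookup (restrict w (p ∩ q)) i                          ≡⟨ restrict-lookup w (p ∩ q) i ⟩
  Vec.lookup (p ∩ q) (punchIn w i)                           ≡⟨ lookup-zipWith _∧_ (punchIn w i) p q ⟩
  Vec.lookup p (punchIn w i) ∧ Vec.lookup q (punchIn w i)    ≡⟨ cong₂ _∧_ (restrict-lookup w p i) (restrict-lookup w q i) ⟨
  Vec.lookup (restrict w p) i ∧ Vec.lookup (restrict w q) i  ≡⟨ lookup-zipWith _∧_ i (restrict w p) (restrict w q) ⟨
  Vec.lookup (restrict w p ∩ restrict w q) i                 ∎
  where open ≡-Reasoning

card-restrict : ∀ {n} {w : Fin (suc n)} {p} → w ∉ p → ∣ restrict w p ∣ ≡ ∣ p ∣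
card-restrict {n} {w} {p} w∉p = begin
  ∣ restrict w p ∣                  ≡⟨ ∣p∣≡∑χ (restrict w p) ⟩
  sum (χ (restrict w p))            ≡⟨ sum-cong-≗ (λ i → cong bit (restrict-lookup w p i)) ⟩
  ∑[ i < n ] χ p (punchIn w i)      ≡⟨ cong (_+ ∑[ i < n ] χ p (punchIn w i)) (χ-∉ w∉p) ⟨
  χ p w + ∑[ i < n ] χ p (punchIn w i) ≡⟨ sum-remove {i = w} (χ p) ⟨
  sum (χ p)                         ≡⟨ ∣p∣≡∑χ p ⟨
  ∣ p ∣                             ∎
  where open ≡-Reasoning

card-restrict-∩ : ∀ {n} {w : Fin (suc n)} {p} q → w ∉ p → ∣ restrict w p ∩ restrict w q ∣ ≡ ∣ p ∩ q ∣
card-restrict-∩ {w = w} {p} q w∉p =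
  trans (cong ∣_∣ (sym (restrict-∩ w p q))) (card-restrict (w∉p ∘ proj₁ ∘ x∈p∩q⁻ p q))

restrict-injective : ∀ {n} {w : Fin (suc n)} {p q} → w ∉ p → w ∉ q → restrict w p ≡ restrict w q → p ≡ q
restrict-injective {w = w} {p} {q} w∉p w∉q same = vec-ext agree
  where
  agree : ∀ x → Vec.lookup p x ≡ Vec.lookup q x
  agree x with x ≟ᶠ w
  ... | yes refl = trans (∉⇒false w∉p) (sym (∉⇒false w∉q))
  ... | no  x≢w  = subst (λ y → Vec.lookup p y ≡ Vec.lookup q y) (Finₚ.punchIn-punchOut w≢x) (begin
        Vec.lookup p (punchIn w j)     ≡⟨ restrict-lookup w p j ⟨
        Vec.lookup (restrict w p) j    ≡⟨ cong (λ r → Vec.lookup r j) same ⟩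
        Vec.lookup (restrict w q) j    ≡⟨ restrict-lookup w q j ⟩
        Vec.lookup q (punchIn w j)     ∎)
    where
    open ≡-Reasoning
    w≢x : w ≢ x
    w≢x = x≢w ∘ sym
    j : Fin _
    j = punchOut w≢x

Group-restrict : ∀ {n k} (grp : Fin (suc n) → Fin k) (w : Fin (suc n)) c →
  Group (grp ∘ punchIn w) c ≡ restrict w (Group grp c)
Group-restrict grp w c = tabulate-cong (λ i → sym (lookup∘tabulate (λ x → does (grp x ≟ᶠ c)) (punchIn w i)))

truncate-All : ∀ {n} {P : Subset (suc n) → Set} {Q : Subset n → Set} (w : Fin (suc n)) →
  (∀ {e} → w ∉ e → P e → Q (restrict w e)) → ∀ {E} → All P E → All Q (truncate w E)
truncate-All w restricts [] = []
truncate-All w restricts {e ∷ E} (pe ∷ pE) with w ∈? e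
... | yes _   = truncate-All w restricts pE
... | no  w∉e = restricts w∉e pe ∷ truncate-All w restricts pE

truncate-AllPairs : ∀ {n} {R : Subset (suc n) → Subset (suc n) → Set} {S : Subset n → Subset n → Set}
  (w : Fin (suc n)) → (∀ {a b} → w ∉ a → w ∉ b → R a b → S (restrict w a) (restrict w b)) →
  ∀ {E} → AllPairs R E → AllPairs S (truncate w E)
truncate-AllPairs w restricts [] = []
truncate-AllPairs w restricts {e ∷ E} (re ∷ rE) with w ∈? e
... | yes _   = truncate-AllPairs w restricts rE
... | no  w∉e = truncate-All w (restricts w∉e) re ∷ truncate-AllPairs w restricts rE

length-truncate : ∀ {n} (w : Fin (suc n)) E → length E ≡ length (truncate w E) + deg E w
length-truncate w [] = refl
length-truncate w (e ∷ E) with w ∈? e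
... | yes w∈e = trans (cong suc (length-truncate w E)) (trans (sym (+-suc _ _))
                  (cong (λ z → length (truncate w E) + (z + deg E w)) (sym (χ-∈ w∈e))))
... | no  w∉e = cong suc (trans (length-truncate w E)
                  (cong (λ z → length (truncate w E) + (z + deg E w)) (sym (χ-∉ w∉e))))

AllPairs⇒pairwise : ∀ {A : Set} {R : A → A → Set} → (∀ {a b} → R a b → R b a) →
  ∀ {xs} → AllPairs R xs → ∀ i j → i ≢ j → R (lookup xs i) (lookup xs j)
AllPairs⇒pairwise R-sym (_  ∷ _)   zero    zero    0≢0 = contradiction refl 0≢0
AllPairs⇒pairwise R-sym (rx ∷ _)   zero    (suc j) _   = allAt rx j
AllPairs⇒pairwise R-sym (rx ∷ _)   (suc i) zero    _   = R-sym (allAt rx i)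
AllPairs⇒pairwise R-sym (_  ∷ rxs) (suc i) (suc j) i≢j = AllPairs⇒pairwise R-sym rxs i j (i≢j ∘ cong suc)

pairwise⇒AllPairs : ∀ {A : Set} {R : A → A → Set} (xs : List A) →
  (∀ i j → i ≢ j → R (lookup xs i) (lookup xs j)) → AllPairs R xs
pairwise⇒AllPairs []       R-at = []
pairwise⇒AllPairs {R = R} (x ∷ xs) R-at =
  All.tabulate (λ y∈xs → subst (R x) (sym (lookup-index y∈xs)) (R-at zero (suc (Any.index y∈xs)) (λ ())))
  ∷ pairwise⇒AllPairs xs (λ i j i≢j → R-at (suc i) (suc j) (i≢j ∘ Finₚ.suc-injective))

truncate-unique : ∀ {n} (w : Fin (suc n)) {E} → Unique E → Unique (truncate w E)
truncate-unique w = truncate-AllPairs w (λ w∉a w∉b a≢b → a≢b ∘ restrict-injective w∉a w∉b)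

truncate-uniform : ∀ {n k} (w : Fin (suc n)) {E} → Uniform k E → Uniform k (truncate w E)
truncate-uniform w = truncate-All w (λ w∉e size → trans (card-restrict w∉e) size)

truncate-linear : ∀ {n} (w : Fin (suc n)) {E} → Linear E → Linear (truncate w E)
truncate-linear w {E} linear = AllPairs⇒pairwise (λ {a} {b} → subst (_≤ 1) (cong ∣_∣ (∩-comm a b)))
  (truncate-AllPairs w (λ {a} {b} w∉a _ → subst (_≤ 1) (sym (card-restrict-∩ b w∉a)))
                       (pairwise⇒AllPairs E linear))

truncate-transversal : ∀ {n k} (grp : Fin (suc n) → Fin k) (w : Fin (suc n)) {E} →
  All (λ e → ∀ c → ∣ e ∩ Group grp c ∣ ≡ 1) E →
  All (λ e → ∀ c → ∣ e ∩ Group (grp ∘ punchIn w) c ∣ ≡ 1) (truncate w E)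
truncate-transversal grp w = truncate-All w λ {e} w∉e meets c →
  trans (cong (λ G → ∣ restrict w e ∩ G ∣) (Group-restrict grp w c)) (trans (card-restrict-∩ (Group grp c) w∉e) (meets c))

-- The truncated design has (m + 1)² - (m + 1) edges: the design has one edge per
-- pair of vertices from two fixed groups, and the deleted vertex lies on m + 1 edges.
truncated-design-size : ∀ {k' m n E grp} → suc n ≡ (2 + k') * suc m →
  TransversalDesign (2 + k') (suc n) E grp → ∀ w → length (truncate w E) ≡ m * m + m
truncated-design-size {k'} {m} {n} {E} {grp} vertices design@(_ , _ , group-size , _ , _) w =
  +-cancelʳ-≡ (suc m) _ _ (begin
    length (truncate w E) + suc m           ≡⟨ cong (length (truncate w E) +_) (trans (sym (size other)) (sym degree)) ⟩
    length (truncate w E) + deg E w         ≡⟨ length-truncate w E ⟨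
    length E                                ≡⟨ design-size design {zero} {suc zero} (λ ()) ⟩
    ∣ Group grp zero ∣ * ∣ Group grp (suc zero) ∣ ≡⟨ cong₂ _*_ (size zero) (size (suc zero)) ⟩
    suc m * suc m                           ≡⟨ square m ⟩
    m * m + m + suc m                       ∎)
  where
  open ≡-Reasoning
  size : ∀ c → ∣ Group grp c ∣ ≡ suc m
  size c = *-cancelʳ-≡ _ _ (2 + k') (trans (group-size c) (trans vertices (*-comm (2 + k') (suc m))))
  other : Fin (2 + k')
  other with grp w
  ... | zero  = suc zero
  ... | suc _ = zero
  degree : deg E w ≡ ∣ Group grp other ∣
  degree = design-degree design w other≢
    where
    other≢ : other ≢ grp w
    other≢ with grp w
    ... | zero  = λ ()
    ... | suc _ = λ ()
  square : ∀ m → suc m * suc m ≡ m * m + m + suc m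
  square = solve-∀

theorem1p2 : ∀ (k m n : ℕ) → 2 ≤ k → suc n ≡ k * suc m →
    ((E : List (Subset n)) → Unique E → Uniform k E → Linear E →
       ¬ ContainsFan k E → length E ≤ m * m + m)
    × ((E : List (Subset (suc n))) (grp : Fin (suc n) → Fin k) →
       TransversalDesign k (suc n) E grp → (w : Fin (suc n)) →
       Unique (truncate w E) × Uniform k (truncate w E) × Linear (truncate w E)
       × ¬ ContainsFan k (truncate w E) × length (truncate w E) ≡ m * m + m)
theorem1p2 (suc (suc k')) m zero (s≤s (s≤s z≤n)) vertices = ⊥-elim (m+1+n≢0 m (sym (suc-injective vertices)))
theorem1p2 (suc (suc k')) m (suc n) (s≤s (s≤s z≤n)) vertices =
    (λ E _ uniform linear fan-free → upper-bound k' m n E vertices uniform linear fan-free)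
  , λ E grp design@(unique , uniform , _ , transversal , _) w →
        truncate-unique w unique
      , truncate-uniform w uniform
      , truncate-linear w {E} (design-linear {E = E} design)
      , transversal-fan-free (grp ∘ punchIn w) (truncate-uniform w uniform) (truncate-transversal grp w transversal)
      , truncated-design-size vertices design w
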